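{- Any colored tree poset without blocking triples is balanced.
   Context: A tree poset is either empty or a finite poset in which every element except one (the root) covers exactly one element. A colored poset has each element colored black or white. A blocking triple is a triple $x\lessdot y\lessdot z$ (each a covering relation) with $x,y$ of the same color and $z$ of a different color. The pomax game on a colored finite poset: White and Black alternately remove a maximal element (of the remaining subposet) of their own color; a player who cannot move loses. A position (a remaining set of elements with induced order and coloring) is balanced if (i) every position reachable from it in one move (by either player) is balanced, and (ii) whenever all its removable (here: maximal) elements are of the same color, at least half of its elements have that color. A colored poset is balanced if its pomax game is balanced. -}

module Defs where

open import Data.Nat using (ℕ; zero; suc; _*_; _≤_)
open import Data.Fin using (Fin)
open import Data.Fin.Subset using (Subset; _∈_; ∣_∣; _∩_; inside; outside)
open import Data.Vec using (tabulate; _[_]≔_)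
open import Data.Product using (Σ; ∃; ∃-syntax; _×_; _,_)
open import Data.Sum using (_⊎_)
open import Data.Bool using (if_then_else_)
open import Relation.Nullary using (¬_; Dec; yes; no)
open import Relation.Nullary.Decidable using (⌊_⌋)
open import Relation.Binary.PropositionalEquality using (_≡_; _≢_; refl)
open import Relation.Binary.Structures using (IsDecPartialOrder)

record FinPoset (n : ℕ) : Set₁ where
  field
    _≼_ : Fin n → Fin n → Set
    isDecPartialOrder : IsDecPartialOrder _≡_ _≼_

  _≺_ : Fin n → Fin n → Set
  x ≺ y = x ≼ y × x ≢ y

  _⋖_ : Fin n → Fin n → Set
  x ⋖ y = x ≺ y × (∀ z → x ≺ z → ¬ (z ≺ y))

open FinPoset public

CoversExactlyOne : ∀ {n} → FinPoset n → Fin n → Set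
CoversExactlyOne P x = ∃[ y ] (_⋖_ P y x × (∀ z → _⋖_ P z x → z ≡ y))

IsTreePoset : ∀ {n} → FinPoset n → Set
IsTreePoset {n} P = n ≡ 0 ⊎ (∃[ r ] (∀ x → x ≢ r → CoversExactlyOne P x))

data Color : Set where
  black white : Color

_≟ᶜ_ : (c d : Color) → Dec (c ≡ d)
black ≟ᶜ black = yes refl
black ≟ᶜ white = no (λ ())
white ≟ᶜ black = no (λ ())
white ≟ᶜ white = yes refl

BlockingTriple : ∀ {n} → FinPoset n → (Fin n → Color) → Fin n → Fin n → Fin n → Set
BlockingTriple P col x y z =
  _⋖_ P x y × _⋖_ P y z × col x ≡ col y × col z ≢ col y

NoBlockingTriples : ∀ {n} → FinPoset n → (Fin n → Color) → Set
NoBlockingTriples P col = ∀ x y z → ¬ BlockingTriple P col x y z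

-- positions are subsets of the elements; the induced order is the restriction
-- x is a maximal element of the remaining subposet S
MaximalIn : ∀ {n} → FinPoset n → Subset n → Fin n → Set
MaximalIn P S x = x ∈ S × (∀ y → y ∈ S → ¬ (_≺_ P x y))

colorClass : ∀ {n} → (Fin n → Color) → Color → Subset n
colorClass col c = tabulate (λ x → if ⌊ col x ≟ᶜ c ⌋ then inside else outside)

countColor : ∀ {n} → (Fin n → Color) → Subset n → Color → ℕ
countColor col S c = ∣ S ∩ colorClass col c ∣

remove : ∀ {n} → Subset n → Fin n → Subset n
remove S x = S [ x ]≔ outside

-- balanced positions (inductive; every move removes an element so the game is finite).
-- A move (by either player) removes a maximal element of the remaining subposet.
data BalancedPos {n} (P : FinPoset n) (col : Fin n → Color) (S : Subset n) : Set where
  balanced :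
    (∀ x → MaximalIn P S x → BalancedPos P col (remove S x)) →
    (∀ c → (∀ x → MaximalIn P S x → col x ≡ c) → ∣ S ∣ ≤ 2 * countColor col S c) →
    BalancedPos P col S

Balanced : ∀ {n} → FinPoset n → (Fin n → Color) → Set
Balanced {n} P col = BalancedPos P col Data.Fin.Subset.⊤

-- The positions reachable in the pomax game are the down-closed subsets. Let S be down-closed with
-- all maximal elements of colour c. An element of the other colour is not maximal, so it is covered
-- by some element of S; if every such cover had its own colour, climbing along them would reach a
-- maximal element of colour c through a blocking triple. Hence every element of the other colour is
-- covered by an element of colour c, and since in a tree every element covers at most one element,
-- this assignment is injective: at least half of S has colour c.
module Submission where

open import Defs hiding (_≼_; _≺_; _⋖_; isDecPartialOrder)
open import Data.Bool using (if_then_else_)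
open import Data.Nat using (ℕ; suc; _+_; _*_; _≤_; z≤n; s≤s)
open import Data.Nat.Properties using (+-suc; +-identityʳ; +-monoʳ-≤; module ≤-Reasoning)
open import Data.Fin using (Fin; zero; suc; _≟_)
open import Data.Fin.Properties using (any?; ¬Fin0)
open import Data.Fin.Induction using (po-wellFounded; po-noetherian)
open import Data.Fin.Subset using (Subset; _∈_; _∉_; _⊆_; _⊂_; ∣_∣; _∩_; ∁; inside; outside; ⊤)
open import Data.Fin.Subset.Properties using (_∈?_; nonempty?; Empty-unique; ∣⊥∣≡0; ∈⊤; x∈p∩q⁺; x∈p∩q⁻; x∈∁p⇒x∉p)
open import Data.Fin.Subset.Induction using (⊂-wellFounded)
open import Data.Vec using (_∷_; []; here; there)
open import Data.Vec.Properties using ([]=-injective; []≔-updates; []≔-minimal; lookup⇒[]=; lookup∘tabulate)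
open import Data.Product using (∃-syntax; _×_; _,_; proj₁; proj₂)
open import Data.Sum using (inj₁; inj₂)
open import Data.Empty using (⊥)
open import Function using (flip; _∘_)
open import Induction.WellFounded using (WellFounded; Acc; acc)
open import Relation.Nullary using (¬_; Dec; yes; no; contradiction)
open import Relation.Nullary.Decidable using (⌊_⌋; _×-dec_)
open import Relation.Binary.PropositionalEquality using (_≡_; _≢_; refl; sym; trans; cong; subst; subst₂)
open import Relation.Binary.Structures using (IsDecPartialOrder)
import Relation.Binary.Construct.NonStrictToStrict as ToStrict

private
  variable
    n : ℕ
    p q : Subset n
    x y : Fin n

x∉remove : ∀ (p : Subset n) x → x ∉ remove p x
x∉remove p x x∈ with []=-injective x∈ ([]≔-updates p x)
... | ()

∈-remove⁺ : y ∈ p → y ≢ x → y ∈ remove p x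
∈-remove⁺ {p = p} y∈p y≢x = []≔-minimal p _ _ y≢x y∈p

∈-remove⇒≢ : y ∈ remove p x → y ≢ x
∈-remove⇒≢ {p = p} y∈ refl = x∉remove p _ y∈

remove⊆ : ∀ (p : Subset n) x → remove p x ⊆ p
remove⊆ (_ ∷ p) zero    (there y∈) = there y∈
remove⊆ (_ ∷ p) (suc x) here       = here
remove⊆ (_ ∷ p) (suc x) (there y∈) = there (remove⊆ p x y∈)

remove⊂ : x ∈ p → remove p x ⊂ p
remove⊂ {x = x} {p = p} x∈p = remove⊆ p x , x , x∈p , x∉remove p x

∣remove∣ : ∀ (p : Subset n) x → x ∈ p → suc ∣ remove p x ∣ ≡ ∣ p ∣
∣remove∣ (inside  ∷ p) zero    here       = refl
∣remove∣ (inside  ∷ p) (suc x) (there x∈) = cong suc (∣remove∣ p x x∈)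
∣remove∣ (outside ∷ p) (suc x) (there x∈) = ∣remove∣ p x x∈

∣p∣≡∣p∩q∣+∣p∩∁q∣ : ∀ (p q : Subset n) → ∣ p ∣ ≡ ∣ p ∩ q ∣ + ∣ p ∩ ∁ q ∣
∣p∣≡∣p∩q∣+∣p∩∁q∣ []            []            = refl
∣p∣≡∣p∩q∣+∣p∩∁q∣ (outside ∷ p) (_ ∷ q)       = ∣p∣≡∣p∩q∣+∣p∩∁q∣ p q
∣p∣≡∣p∩q∣+∣p∩∁q∣ (inside  ∷ p) (inside ∷ q)  = cong suc (∣p∣≡∣p∩q∣+∣p∩∁q∣ p q)
∣p∣≡∣p∩q∣+∣p∩∁q∣ (inside  ∷ p) (outside ∷ q) =
  trans (cong suc (∣p∣≡∣p∩q∣+∣p∩∁q∣ p q)) (sym (+-suc ∣ p ∩ q ∣ ∣ p ∩ ∁ q ∣))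

matching⇒∣p∣≤∣q∣ : {R : Fin n → Fin n → Set} →
  (∀ {x} → x ∈ p → ∃[ y ] (y ∈ q × R x y)) →
  (∀ {x x′ y} → R x y → R x′ y → x ≡ x′) →
  ∣ p ∣ ≤ ∣ q ∣
matching⇒∣p∣≤∣q∣ {n = n} {p = p} {q = q} {R = R} match R-injective = go p (⊂-wellFounded p) q match
  where
  go : ∀ p → Acc _⊂_ p → ∀ q → (∀ {x} → x ∈ p → ∃[ y ] (y ∈ q × R x y)) → ∣ p ∣ ≤ ∣ q ∣
  go p (acc rs) q match with nonempty? p
  ... | no p-empty = subst (_≤ ∣ q ∣) (sym (trans (cong ∣_∣ (Empty-unique p-empty)) (∣⊥∣≡0 n))) z≤n
  ... | yes (x , x∈p) with match x∈p
  ...   | y , y∈q , Rxy =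
    subst₂ _≤_ (∣remove∣ p x x∈p) (∣remove∣ q y y∈q)
      (s≤s (go (remove p x) (rs (remove⊂ x∈p)) (remove q y) match′))
    where
    match′ : ∀ {x′} → x′ ∈ remove p x → ∃[ y′ ] (y′ ∈ remove q y × R x′ y′)
    match′ x′∈ with match (remove⊆ p x x′∈)
    ... | y′ , y′∈q , Rx′y′ =
      y′ , ∈-remove⁺ y′∈q (λ { refl → ∈-remove⇒≢ x′∈ (R-injective Rx′y′ Rxy) }) , Rx′y′

≢∧≢⇒≡ : ∀ {a b c : Color} → a ≢ c → b ≢ c → a ≡ b
≢∧≢⇒≡ {black} {black}         _   _   = refl
≢∧≢⇒≡ {white} {white}         _   _   = refl
≢∧≢⇒≡ {black} {white} {black} a≢c _   = contradiction refl a≢c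
≢∧≢⇒≡ {black} {white} {white} _   b≢c = contradiction refl b≢c
≢∧≢⇒≡ {white} {black} {black} _   b≢c = contradiction refl b≢c
≢∧≢⇒≡ {white} {black} {white} a≢c _   = contradiction refl a≢c

∈-colorClass⁺ : ∀ (col : Fin n → Color) {c} x → col x ≡ c → x ∈ colorClass col c
∈-colorClass⁺ col x refl = lookup⇒[]= x _ (trans (lookup∘tabulate _ x) (inside-if-same (col x)))
  where
  inside-if-same : ∀ a → (if ⌊ a ≟ᶜ a ⌋ then inside else outside) ≡ inside
  inside-if-same black = refl
  inside-if-same white = refl

module FinPosetProperties {n} (P : FinPoset n) where
  open FinPoset P using (_≼_; _≺_; _⋖_; isDecPartialOrder)
  open IsDecPartialOrder isDecPartialOrder using (isPartialOrder; _≤?_)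
    renaming (refl to ≼-refl; trans to ≼-trans)

  ≺-wellFounded : WellFounded _≺_
  ≺-wellFounded = po-wellFounded isPartialOrder

  ≺-noetherian : WellFounded (flip _≺_)
  ≺-noetherian = po-noetherian isPartialOrder

  _≺?_ : ∀ x y → Dec (x ≺ y)
  _≺?_ = ToStrict.<-decidable _≡_ _≼_ _≟_ _≤?_

  ≺-trans : ∀ {x y z} → x ≺ y → y ≺ z → x ≺ z
  ≺-trans = ToStrict.<-trans _≡_ _≼_ isPartialOrder

  cover-between : ∀ {x y} → x ≺ y → ∃[ z ] (x ⋖ z × z ≼ y)
  cover-between {x} {y} x≺y = go y (≺-wellFounded y) x≺y
    where
    go : ∀ y → Acc _≺_ y → x ≺ y → ∃[ z ] (x ⋖ z × z ≼ y)
    go y (acc rs) x≺y with any? (λ z → (x ≺? z) ×-dec (z ≺? y))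
    ... | no ∄z = y , (x≺y , λ z x≺z z≺y → ∄z (z , x≺z , z≺y)) , ≼-refl
    ... | yes (z , x≺z , z≺y) with go z (rs z≺y) x≺z
    ...   | w , x⋖w , w≼z = w , x⋖w , ≼-trans w≼z (proj₁ z≺y)

  lowerCover-unique : IsTreePoset P → ∀ {x y z} → x ⋖ z → y ⋖ z → x ≡ y
  lowerCover-unique (inj₁ n≡0) {z = z} = contradiction (subst Fin n≡0 z) ¬Fin0
  lowerCover-unique (inj₂ (r , coversOne)) {x} {y} {z} x⋖z y⋖z with z ≟ r
  ... | yes refl = contradiction (proj₁ x⋖z) (nothing-below-root x (≺-wellFounded x))
    where
    nothing-below-root : ∀ w → Acc _≺_ w → ¬ w ≺ r
    nothing-below-root w (acc rs) w≺r with coversOne w (proj₂ w≺r)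
    ... | v , v⋖w , _ = nothing-below-root v (rs (proj₁ v⋖w)) (≺-trans (proj₁ v⋖w) w≺r)
  ... | no z≢r with coversOne z z≢r
  ...   | _ , _ , unique = trans (unique x x⋖z) (sym (unique y y⋖z))

  DownClosed : Subset n → Set
  DownClosed S = ∀ {x y} → y ∈ S → x ≼ y → x ∈ S

  upperCover : ∀ {S x} → DownClosed S → x ∈ S → ¬ MaximalIn P S x → ∃[ z ] (z ∈ S × x ⋖ z)
  upperCover {S} {x} S-closed x∈S x-notMax with any? (λ z → (z ∈? S) ×-dec (x ≺? z))
  ... | no ∄z = contradiction (x∈S , λ z z∈S x≺z → ∄z (z , z∈S , x≺z)) x-notMax
  ... | yes (z , z∈S , x≺z) with cover-between x≺z
  ...   | w , x⋖w , w≼z = w , S-closed z∈S w≼z , x⋖w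

  remove-downClosed : ∀ {S x} → DownClosed S → MaximalIn P S x → DownClosed (remove S x)
  remove-downClosed {S} {x} S-closed (_ , x-max) {z} {y} y∈ z≼y with z ≟ x
  ... | yes refl = contradiction (z≼y , ∈-remove⇒≢ y∈ ∘ sym) (x-max y (remove⊆ S x y∈))
  ... | no z≢x = ∈-remove⁺ (S-closed (remove⊆ S x y∈) z≼y) z≢x

module _ {n} {P : FinPoset n} {col : Fin n → Color}
         (tree : IsTreePoset P) (noBlocking : NoBlockingTriples P col) where
  open FinPoset P using (_≺_; _⋖_)
  open FinPosetProperties P

  module _ {S} (S-closed : DownClosed S) {c} (maximal⇒c : ∀ x → MaximalIn P S x → col x ≡ c) where

    ¬monochromeCover : ∀ y → Acc (flip _≺_) y → ∀ {x} →
      y ∈ S → x ⋖ y → col x ≡ col y → col y ≢ c → ⊥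
    ¬monochromeCover y (acc rs) {x} y∈S x⋖y x≡y y≢c
      with upperCover S-closed y∈S (y≢c ∘ maximal⇒c y)
    ... | z , z∈S , y⋖z with col z ≟ᶜ col y
    ...   | no z≢y = noBlocking x y z (x⋖y , y⋖z , x≡y , z≢y)
    ...   | yes z≡y =
      ¬monochromeCover z (rs (proj₁ y⋖z)) z∈S y⋖z (sym z≡y) (y≢c ∘ trans (sym z≡y))

    coveredBy-c : ∀ {x} → x ∈ S → col x ≢ c → ∃[ z ] (z ∈ S ∩ colorClass col c × x ⋖ z)
    coveredBy-c {x} x∈S x≢c with upperCover S-closed x∈S (x≢c ∘ maximal⇒c x)
    ... | z , z∈S , x⋖z with col z ≟ᶜ c
    ...   | yes z≡c = z , x∈p∩q⁺ (z∈S , ∈-colorClass⁺ col z z≡c) , x⋖z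
    ...   | no z≢c  = contradiction (≢∧≢⇒≡ x≢c z≢c)
                        (λ x≡z → ¬monochromeCover z (≺-noetherian z) z∈S x⋖z x≡z z≢c)

    half-have-color : ∣ S ∣ ≤ 2 * countColor col S c
    half-have-color = begin
      ∣ S ∣                   ≡⟨ ∣p∣≡∣p∩q∣+∣p∩∁q∣ S C ⟩
      ∣ S ∩ C ∣ + ∣ S ∩ ∁ C ∣ ≤⟨ +-monoʳ-≤ ∣ S ∩ C ∣ off-c≤c ⟩
      ∣ S ∩ C ∣ + ∣ S ∩ C ∣   ≡⟨ cong (∣ S ∩ C ∣ +_) (sym (+-identityʳ ∣ S ∩ C ∣)) ⟩
      2 * ∣ S ∩ C ∣           ∎
      where
      open ≤-Reasoning
      C = colorClass col c
      off-c≤c : ∣ S ∩ ∁ C ∣ ≤ ∣ S ∩ C ∣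
      off-c≤c = matching⇒∣p∣≤∣q∣ off-c-covered (lowerCover-unique tree)
        where
        off-c-covered : ∀ {x} → x ∈ S ∩ ∁ C → ∃[ z ] (z ∈ S ∩ C × x ⋖ z)
        off-c-covered {x} x∈ with x∈p∩q⁻ S (∁ C) x∈
        ... | x∈S , x∈∁C = coveredBy-c x∈S (x∈∁p⇒x∉p x∈∁C ∘ ∈-colorClass⁺ col x)

  downClosed⇒balanced : ∀ S → DownClosed S → BalancedPos P col S
  downClosed⇒balanced S = go S (⊂-wellFounded S)
    where
    go : ∀ S → Acc _⊂_ S → DownClosed S → BalancedPos P col S
    go S (acc rs) S-closed = balanced
      (λ x x-max → go (remove S x) (rs (remove⊂ (proj₁ x-max))) (remove-downClosed S-closed x-max))
      (λ c → half-have-color S-closed)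

mainTheorem6 : ∀ (n : ℕ) (P : FinPoset n) (col : Fin n → Color) →
    IsTreePoset P → NoBlockingTriples P col → Balanced P col
mainTheorem6 n P col tree noBlocking = downClosed⇒balanced tree noBlocking ⊤ (λ _ _ → ∈⊤)
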